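{- Let $k\ge1$ be an integer, let $G$ be a connected graph, $w\colon V(G)\to\mathbb{Q}_{>0}$, and let $\mathcal{P}_k(G,w)$ be the convex hull of all $x\in\{0,1\}^{V(G)\times[k]}$ satisfying (a) $\sum_{v\in V(G)} w(v)\,x_{v,i}\le \sum_{v\in V(G)} w(v)\,x_{v,i+1}$ for all $i\in[k-1]$; (b) $\sum_{i\in[k]} x_{v,i}\le 1$ for all $v\in V(G)$; (c) $x_{u,i}+x_{v,i}-\sum_{z\in S}x_{z,i}\le 1$ for every pair of distinct non-adjacent vertices $u,v$, every minimal $(u,v)$-separator $S$, and every $i\in[k]$. Let $u,v$ be two non-adjacent vertices of $G$ and let $S$ be a minimal $(u,v)$-separator. For every $i\in[k]$, letting $$L=\Big\{z\in S\colon w(P_z)>\tfrac{w(G)}{k-i+1}\Big\},$$ where $P_z$ is a minimum-weight path between $u$ and $v$ in $G$ containing $z$, the inequality $$x_{u,i}+x_{v,i}-\sum_{z\in S\setminus L}x_{z,i}\le 1$$ is valid for $\mathcal{P}_k(G,w)$.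
   Context: $[k]=\{1,\dots,k\}$. For non-adjacent vertices $u,v$, a $(u,v)$-separator is a set $S\subseteq V(G)\setminus\{u,v\}$ such that $u,v$ are in different components of $G-S$; minimal means inclusion-minimal. For $V'\subseteq V(G)$, $w(V')=\sum_{v\in V'}w(v)$, and for a subgraph (or path) $H$, $w(H)=w(V(H))$. An inequality is valid for a polytope if every point of the polytope satisfies it.
   Formalization: The inequality is asserted only for points of $\mathcal{P}_k(G,w)$ that are convex combinations with rational coefficients of the feasible 0/1 points. -}

module Defs where

open import Data.Nat as ℕ using (ℕ; zero; suc; _∸_)
open import Data.Integer using (+_)
open import Data.Fin using (Fin; toℕ) renaming (zero to fzero; suc to fsuc)
open import Data.Fin.Subset using (Subset; _∈_; _∉_; _⊂_)
open import Data.Bool using (Bool; true; false; if_then_else_)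
open import Data.List using (List; []; _∷_; foldr; map)
open import Data.List.Relation.Unary.All using (All)
open import Data.List.Relation.Unary.Any using (Any)
open import Data.List.Relation.Unary.Unique.Propositional using (Unique)
open import Data.List.Membership.Propositional using () renaming (_∈_ to _∈ₗ_)
open import Data.Product using (Σ; ∃; _×_)
open import Data.Vec using (lookup)
open import Data.Rational using (ℚ; 0ℚ; 1ℚ; _+_; _*_; _-_; _≤_; _<_; _/_)
open import Relation.Binary.PropositionalEquality using (_≡_; _≢_)
open import Relation.Nullary using (¬_)
open import Level using (0ℓ)

record Graph (n : ℕ) : Set₁ where
  field
    Adj    : Fin n → Fin n → Set
    sym    : ∀ {a b} → Adj a b → Adj b a
    irrefl : ∀ {a} → ¬ Adj a a
open Graph public

ΣFin : ∀ {m} → (Fin m → ℚ) → ℚ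
ΣFin {zero}  f = 0ℚ
ΣFin {suc m} f = f fzero + ΣFin (λ j → f (fsuc j))

ΣOver : ∀ {n} → Subset n → (Fin n → ℚ) → ℚ
ΣOver T f = ΣFin (λ z → if lookup T z then f z else 0ℚ)

data Walk {n} (G : Graph n) : Fin n → Fin n → List (Fin n) → Set where
  single : ∀ a → Walk G a a (a ∷ [])
  step   : ∀ {a b c P} → Adj G a b → Walk G b c P → Walk G a c (a ∷ P)

IsPath : ∀ {n} → Graph n → Fin n → Fin n → List (Fin n) → Set
IsPath G a b P = Walk G a b P × Unique P

Connected : ∀ {n} → Graph n → Set
Connected G = ∀ a b → ∃ λ P → IsPath G a b P

IsSeparator : ∀ {n} → Graph n → Fin n → Fin n → Subset n → Set
IsSeparator G u v S =
  u ∉ S × v ∉ S × ¬ (∃ λ P → IsPath G u v P × All (λ z → z ∉ S) P)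

IsMinimalSeparator : ∀ {n} → Graph n → Fin n → Fin n → Subset n → Set
IsMinimalSeparator G u v S =
  IsSeparator G u v S × (∀ S′ → S′ ⊂ S → ¬ IsSeparator G u v S′)

wList : ∀ {n} → (Fin n → ℚ) → List (Fin n) → ℚ
wList w P = foldr _+_ 0ℚ (map w P)

wGraph : ∀ {n} → (Fin n → ℚ) → ℚ
wGraph w = ΣFin w

-- Points of ℚ^{V(G) × [k]}; [k] is represented by Fin k (index i ↦ i+1).
Point : ℕ → ℕ → Set
Point n k = Fin n → Fin k → ℚ

B→ℚ : Bool → ℚ
B→ℚ true  = 1ℚ
B→ℚ false = 0ℚ

Feasible : ∀ {n} k → Graph n → (Fin n → ℚ) → (Fin n → Fin k → Bool) → Set
Feasible {n} k G w y =
  (∀ (i j : Fin k) → toℕ j ≡ suc (toℕ i) →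
     ΣFin (λ v → w v * x v i) ≤ ΣFin (λ v → w v * x v j))
  × (∀ v → ΣFin (λ i → x v i) ≤ 1ℚ)
  × (∀ (a b : Fin n) (S : Subset n) (i : Fin k) → a ≢ b → ¬ Adj G a b →
       IsMinimalSeparator G a b S →
       (x a i + x b i) - ΣOver S (λ z → x z i) ≤ 1ℚ)
  where
  x : Point n k
  x v i = B→ℚ (y v i)

InPolytope : ∀ {n} k → Graph n → (Fin n → ℚ) → Point n k → Set
InPolytope {n} k G w x =
  Σ ℕ λ m → Σ (Fin m → (Fin n → Fin k → Bool)) λ p → Σ (Fin m → ℚ) λ λs →
    (∀ j → Feasible k G w (p j))
    × (∀ j → 0ℚ ≤ λs j)
    × ΣFin λs ≡ 1ℚ
    × (∀ v i → x v i ≡ ΣFin (λ j → λs j * B→ℚ (p j v i)))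

IsMinPathThrough : ∀ {n} → Graph n → (Fin n → ℚ) → Fin n → Fin n → Fin n → List (Fin n) → Set
IsMinPathThrough G w u v z P =
  IsPath G u v P × z ∈ₗ P
  × (∀ Q → IsPath G u v Q → z ∈ₗ Q → wList w P ≤ wList w Q)

-- Threshold w(G)/(k−i+1) for the 1-based index i = toℕ i₀ + 1, i.e.
-- k − i + 1 = k − toℕ i₀ = suc (k ∸ suc (toℕ i₀)).
threshold : ∀ {n} k → (Fin n → ℚ) → Fin k → ℚ
threshold k w i = wGraph w * ((+ 1) / suc (k ∸ suc (toℕ i)))

InL : ∀ {n} k → Graph n → (Fin n → ℚ) → Fin n → Fin n → Subset n → Fin k → Fin n → Set
InL k G w u v S i z =
  z ∈ S × ∃ λ P → IsMinPathThrough G w u v z P × threshold k w i < wList w P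

-- By convexity it suffices to check the inequality at a feasible 0/1 point y; only the case
-- y(u,i) = y(v,i) = 1 needs work. The colour classes i, …, k are disjoint and, by (a), each is
-- at least as heavy as class i, so w(class i) ≤ w(G)/(k−i+1). The complement of class i cannot
-- separate u from v: it would contain a minimal separator S′, and (c) for S′ would read 2 ≤ 1.
-- Hence some u–v path Q lies inside class i. Q meets S in some z, and w(P_z) ≤ w(Q) ≤ w(class i)
-- shows z ∉ L, so the sum over S ∖ L is at least y(z,i) = 1.
module Submission where

open import Defs
open import Data.Nat using (ℕ; _≥_)
open import Data.Fin using (Fin)
open import Data.Fin.Subset using (Subset; _∈_; _∉_)
open import Data.Rational using (ℚ; 0ℚ; 1ℚ; _+_; _-_; _≤_; _<_)
open import Data.Product using (_×_)
open import Relation.Binary.PropositionalEquality using (_≢_)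
open import Relation.Nullary using (¬_)
open import Function.Bundles using (_⇔_)

open import Data.Nat as ℕ using (zero; suc; _∸_)
import Data.Nat.Properties as ℕP
import Data.Nat.Coprimality as Coprimality
import Data.Integer as ℤ
import Data.Integer.Properties as ℤP
open import Data.Fin using (toℕ; fromℕ<) renaming (zero to fzero; suc to fsuc)
import Data.Fin.Properties as FinP
open import Data.Fin.Subset using (_⊆_; _⊂_; ∣_∣)
import Data.Fin.Subset.Properties as SubsetP
open import Data.Bool using (Bool; true; false; if_then_else_; not)
import Data.Bool.Properties as BoolP
open import Data.List using (List; []; _∷_)
open import Data.List.Relation.Unary.All as All using (All; []; _∷_)
open import Data.List.Relation.Unary.All.Properties using (¬All⇒Any¬)
open import Data.List.Relation.Unary.Unique.Propositional using (Unique)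
open import Data.List.Relation.Unary.AllPairs using (_∷_)
open import Data.List.Membership.Propositional using (find) renaming (_∈_ to _∈ₗ_)
open import Data.Vec using (lookup; tabulate)
import Data.Vec.Properties as VecP
open import Data.Product using (∃; _,_; proj₁; proj₂)
open import Data.Rational using (_*_; _/_; mkℚ; nonNegative)
import Data.Rational.Properties as ℚP
open import Data.Rational.Solver using (module +-*-Solver)
open +-*-Solver using (solve; _:+_; _:*_; _:-_; _:=_)
open import Relation.Binary.PropositionalEquality as ≡
  using (_≡_; refl; trans; cong; cong₂; subst; module ≡-Reasoning)
open import Relation.Nullary using (yes; no; ¬?)
open import Relation.Nullary.Decidable using (from-yes; from-no; does; decidable-stable; ¬¬-excluded-middle)
open import Data.Empty using (⊥-elim)
open import Function using (_∘_)
open import Function.Bundles using (Equivalence)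

-- Finite sums

B→ℚ-nonneg : ∀ b → 0ℚ ≤ B→ℚ b
B→ℚ-nonneg true  = from-yes (0ℚ ℚP.≤? 1ℚ)
B→ℚ-nonneg false = ℚP.≤-refl

weighted-bit-nonneg : ∀ {a} → 0ℚ ≤ a → ∀ b → 0ℚ ≤ a * B→ℚ b
weighted-bit-nonneg {a} a≥0 true  = subst (0ℚ ≤_) (≡.sym (ℚP.*-identityʳ a)) a≥0
weighted-bit-nonneg {a} a≥0 false = ℚP.≤-reflexive (≡.sym (ℚP.*-zeroʳ a))

Σ-cong : ∀ {m} {f g : Fin m → ℚ} → (∀ j → f j ≡ g j) → ΣFin f ≡ ΣFin g
Σ-cong {zero}  f≗g = refl
Σ-cong {suc m} f≗g = cong₂ _+_ (f≗g fzero) (Σ-cong (f≗g ∘ fsuc))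

Σ-zero : ∀ m → ΣFin {m} (λ _ → 0ℚ) ≡ 0ℚ
Σ-zero zero    = refl
Σ-zero (suc m) = trans (ℚP.+-identityˡ _) (Σ-zero m)

Σ-+ : ∀ {m} (f g : Fin m → ℚ) → ΣFin (λ j → f j + g j) ≡ ΣFin f + ΣFin g
Σ-+ {zero}  f g = refl
Σ-+ {suc m} f g =
  trans (cong (f fzero + g fzero +_) (Σ-+ (f ∘ fsuc) (g ∘ fsuc)))
        (interchange (f fzero) (g fzero) (ΣFin (f ∘ fsuc)) (ΣFin (g ∘ fsuc)))
  where interchange = solve 4 (λ a b c d → (a :+ b) :+ (c :+ d) := (a :+ c) :+ (b :+ d)) refl

Σ-- : ∀ {m} (f g : Fin m → ℚ) → ΣFin (λ j → f j - g j) ≡ ΣFin f - ΣFin g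
Σ-- {zero}  f g = refl
Σ-- {suc m} f g =
  trans (cong (f fzero - g fzero +_) (Σ-- (f ∘ fsuc) (g ∘ fsuc)))
        (interchange (f fzero) (g fzero) (ΣFin (f ∘ fsuc)) (ΣFin (g ∘ fsuc)))
  where interchange = solve 4 (λ a b c d → (a :- b) :+ (c :- d) := (a :+ c) :- (b :+ d)) refl

Σ-*ˡ : ∀ {m} c (f : Fin m → ℚ) → ΣFin (λ j → c * f j) ≡ c * ΣFin f
Σ-*ˡ {zero}  c f = ≡.sym (ℚP.*-zeroʳ c)
Σ-*ˡ {suc m} c f = trans (cong (c * f fzero +_) (Σ-*ˡ c (f ∘ fsuc))) (≡.sym (ℚP.*-distribˡ-+ c _ _))

Σ-comm : ∀ {m n} (f : Fin m → Fin n → ℚ) →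
  ΣFin (λ a → ΣFin (λ b → f a b)) ≡ ΣFin (λ b → ΣFin (λ a → f a b))
Σ-comm {zero}  {n} f = ≡.sym (Σ-zero n)
Σ-comm {suc m}     f =
  trans (cong (ΣFin (f fzero) +_) (Σ-comm (f ∘ fsuc))) (≡.sym (Σ-+ (f fzero) _))

Σ-mono : ∀ {m} {f g : Fin m → ℚ} → (∀ j → f j ≤ g j) → ΣFin f ≤ ΣFin g
Σ-mono {zero}  f≤g = ℚP.≤-refl
Σ-mono {suc m} f≤g = ℚP.+-mono-≤ (f≤g fzero) (Σ-mono (f≤g ∘ fsuc))

Σ-nonneg : ∀ {m} {f : Fin m → ℚ} → (∀ j → 0ℚ ≤ f j) → 0ℚ ≤ ΣFin f
Σ-nonneg {m} {f} f≥0 = subst (_≤ ΣFin f) (Σ-zero m) (Σ-mono f≥0)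

term-≤-Σ : ∀ {m} {f : Fin m → ℚ} → (∀ j → 0ℚ ≤ f j) → ∀ a → f a ≤ ΣFin f
term-≤-Σ {suc m} {f} f≥0 fzero =
  ℚP.≤-trans (ℚP.≤-reflexive (≡.sym (ℚP.+-identityʳ _)))
    (ℚP.+-monoʳ-≤ (f fzero) (Σ-nonneg (f≥0 ∘ fsuc)))
term-≤-Σ {suc m} {f} f≥0 (fsuc a) =
  ℚP.≤-trans (term-≤-Σ (f≥0 ∘ fsuc) a)
    (ℚP.≤-trans (ℚP.≤-reflexive (≡.sym (ℚP.+-identityˡ _))) (ℚP.+-monoˡ-≤ _ (f≥0 fzero)))

Σ-singleton : ∀ {m} (a : Fin m) (h : Fin m → ℚ) →
  ΣFin (λ z → if does (z FinP.≟ a) then h z else 0ℚ) ≡ h a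
Σ-singleton {suc m} fzero    h = trans (cong (h fzero +_) (Σ-zero m)) (ℚP.+-identityʳ _)
Σ-singleton {suc m} (fsuc a) h = trans (ℚP.+-identityˡ _) (Σ-singleton a (h ∘ fsuc))

convex-combination-≤ : ∀ {m} {λs g : Fin m → ℚ} {c} → (∀ j → 0ℚ ≤ λs j) → ΣFin λs ≡ 1ℚ →
  (∀ j → g j ≤ c) → ΣFin (λ j → λs j * g j) ≤ c
convex-combination-≤ {λs = λs} {g} {c} λs≥0 Σλs≡1 g≤c = begin
  ΣFin (λ j → λs j * g j) ≤⟨ Σ-mono (λ j → ℚP.*-monoˡ-≤-nonNeg (λs j) {{nonNegative (λs≥0 j)}} (g≤c j)) ⟩
  ΣFin (λ j → λs j * c)   ≡⟨ Σ-cong (λ j → ℚP.*-comm (λs j) c) ⟩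
  ΣFin (λ j → c * λs j)   ≡⟨ Σ-*ˡ c λs ⟩
  c * ΣFin λs             ≡⟨ cong (c *_) Σλs≡1 ⟩
  c * 1ℚ                  ≡⟨ ℚP.*-identityʳ c ⟩
  c                       ∎
  where open ℚP.≤-Reasoning

ΣOver-cong : ∀ {n} (T : Subset n) {f g : Fin n → ℚ} → (∀ z → f z ≡ g z) → ΣOver T f ≡ ΣOver T g
ΣOver-cong T f≗g = Σ-cong (λ z → cong (if lookup T z then_else 0ℚ) (f≗g z))

selected-nonneg : ∀ b {a} → 0ℚ ≤ a → 0ℚ ≤ (if b then a else 0ℚ)
selected-nonneg true  a≥0 = a≥0
selected-nonneg false _   = ℚP.≤-refl

ΣOver-nonneg : ∀ {n} (T : Subset n) {f : Fin n → ℚ} → (∀ z → 0ℚ ≤ f z) → 0ℚ ≤ ΣOver T f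
ΣOver-nonneg T f≥0 = Σ-nonneg (λ z → selected-nonneg (lookup T z) (f≥0 z))

member-≤-ΣOver : ∀ {n} {T : Subset n} {f : Fin n → ℚ} {z} → (∀ z → 0ℚ ≤ f z) → z ∈ T →
  f z ≤ ΣOver T f
member-≤-ΣOver {T = T} {f} {z} f≥0 z∈T =
  subst (_≤ ΣOver T f) selected≡ (term-≤-Σ (λ z → selected-nonneg (lookup T z) (f≥0 z)) z)
  where
  selected≡ : (if lookup T z then f z else 0ℚ) ≡ f z
  selected≡ rewrite VecP.[]=⇒lookup z∈T = refl

ΣOver-vanishing : ∀ {n} (T : Subset n) {f : Fin n → ℚ} → (∀ {z} → z ∈ T → f z ≡ 0ℚ) →
  ΣOver T f ≡ 0ℚ
ΣOver-vanishing {n} T {f} f≡0 = trans (Σ-cong selected≡0) (Σ-zero n)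
  where
  selected≡0 : ∀ z → (if lookup T z then f z else 0ℚ) ≡ 0ℚ
  selected≡0 z with lookup T z in T[z]
  ... | true  = f≡0 (VecP.lookup⇒[]= z T T[z])
  ... | false = refl

ΣOver-linear : ∀ {m n} (T : Subset n) (λs : Fin m → ℚ) (b : Fin m → Fin n → ℚ) →
  ΣOver T (λ z → ΣFin (λ j → λs j * b j z)) ≡ ΣFin (λ j → λs j * ΣOver T (b j))
ΣOver-linear {m} T λs b =
  trans (Σ-cong select-inside)
    (trans (Σ-comm (λ z j → λs j * (if lookup T z then b j z else 0ℚ)))
      (Σ-cong (λ j → Σ-*ˡ (λs j) (λ z → if lookup T z then b j z else 0ℚ))))
  where
  select-inside : ∀ z → (if lookup T z then ΣFin (λ j → λs j * b j z) else 0ℚ)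
                      ≡ ΣFin (λ j → λs j * (if lookup T z then b j z else 0ℚ))
  select-inside z with lookup T z
  ... | true  = refl
  ... | false = ≡.sym (trans (Σ-cong (λ j → ℚP.*-zeroʳ (λs j))) (Σ-zero m))

sepForm : ∀ {n} → Fin n → Fin n → Subset n → (Fin n → ℚ) → ℚ
sepForm u v T x = (x u + x v) - ΣOver T x

sepForm-cong : ∀ {n} (u v : Fin n) (T : Subset n) {x y : Fin n → ℚ} →
  (∀ z → x z ≡ y z) → sepForm u v T x ≡ sepForm u v T y
sepForm-cong u v T x≗y = cong₂ _-_ (cong₂ _+_ (x≗y u) (x≗y v)) (ΣOver-cong T x≗y)

sepForm-linear : ∀ {m n} (u v : Fin n) (T : Subset n) (λs : Fin m → ℚ) (b : Fin m → Fin n → ℚ) →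
  sepForm u v T (λ z → ΣFin (λ j → λs j * b j z)) ≡ ΣFin (λ j → λs j * sepForm u v T (b j))
sepForm-linear u v T λs b = begin
  (X u + X v) - ΣOver T X
    ≡⟨ cong ((X u + X v) -_) (ΣOver-linear T λs b) ⟩
  (X u + X v) - ΣFin (λ j → λs j * O j)
    ≡⟨ cong (_- ΣFin (λ j → λs j * O j)) (≡.sym (Σ-+ (λ j → λs j * b j u) (λ j → λs j * b j v))) ⟩
  ΣFin (λ j → λs j * b j u + λs j * b j v) - ΣFin (λ j → λs j * O j)
    ≡⟨ ≡.sym (Σ-- (λ j → λs j * b j u + λs j * b j v) (λ j → λs j * O j)) ⟩
  ΣFin (λ j → (λs j * b j u + λs j * b j v) - λs j * O j)
    ≡⟨ Σ-cong (λ j → distrib (λs j) (b j u) (b j v) (O j)) ⟩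
  ΣFin (λ j → λs j * ((b j u + b j v) - O j)) ∎
  where
  open ≡-Reasoning
  X : _ → ℚ
  X z = ΣFin (λ j → λs j * b j z)
  O : _ → ℚ
  O j = ΣOver T (b j)
  distrib = solve 4 (λ l a c o → (l :* a :+ l :* c) :- l :* o := l :* ((a :+ c) :- o)) refl

fromℕ : ℕ → ℚ
fromℕ n = mkℚ (ℤ.+ n) 0 (Coprimality.sym (Coprimality.1-coprimeTo n))

fromℕ-suc : ∀ n → 1ℚ + fromℕ n ≡ fromℕ (suc n)
fromℕ-suc n = trans (ℚP./-cong (cong (λ t → ℤ.+ 1 ℤ.+ t) (ℤP.*-identityʳ (ℤ.+ n))) refl)
                    (ℚP.normalize-coprime (Coprimality.sym (Coprimality.1-coprimeTo (suc n))))

fromℕ-*-recip : ∀ m → fromℕ (suc m) * (ℤ.+ 1 / suc m) ≡ 1ℚ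
fromℕ-*-recip m =
  trans (cong (fromℕ (suc m) *_) (ℚP.normalize-coprime (Coprimality.1-coprimeTo (suc m))))
        (ℚP.*-inverseʳ (fromℕ (suc m)))

≤-*-recip : ∀ m {a b} → fromℕ (suc m) * a ≤ b → a ≤ b * (ℤ.+ 1 / suc m)
≤-*-recip m {a} {b} ma≤b = begin
  a                        ≡⟨ ≡.sym (ℚP.*-identityˡ a) ⟩
  1ℚ * a                   ≡⟨ cong (_* a) (≡.sym (trans (ℚP.*-comm q _) (fromℕ-*-recip m))) ⟩
  q * fromℕ (suc m) * a    ≡⟨ ℚP.*-assoc q _ a ⟩
  q * (fromℕ (suc m) * a)  ≤⟨ ℚP.*-monoˡ-≤-nonNeg q {{ℚP.normalize-nonNeg 1 (suc m)}} ma≤b ⟩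
  q * b                    ≡⟨ ℚP.*-comm q b ⟩
  b * q                    ∎
  where
  open ℚP.≤-Reasoning
  q = ℤ.+ 1 / suc m

const-≤-Σ : ∀ {m} {f : Fin m → ℚ} {c} → (∀ j → c ≤ f j) → fromℕ m * c ≤ ΣFin f
const-≤-Σ {zero}          {c = c} _   = ℚP.≤-reflexive (ℚP.*-zeroˡ c)
const-≤-Σ {suc m} {f = f} {c = c} c≤f = begin
  fromℕ (suc m) * c        ≡⟨ cong (_* c) (≡.sym (fromℕ-suc m)) ⟩
  (1ℚ + fromℕ m) * c       ≡⟨ ℚP.*-distribʳ-+ c 1ℚ (fromℕ m) ⟩
  1ℚ * c + fromℕ m * c     ≡⟨ cong (_+ fromℕ m * c) (ℚP.*-identityˡ c) ⟩
  c + fromℕ m * c          ≤⟨ ℚP.+-mono-≤ (c≤f fzero) (const-≤-Σ (c≤f ∘ fsuc)) ⟩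
  ΣFin f                   ∎
  where open ℚP.≤-Reasoning

tail-≤-Σ : ∀ {m} {f : Fin m → ℚ} {c} (a : Fin m) → (∀ j → 0ℚ ≤ f j) →
  (∀ j → toℕ a ℕ.≤ toℕ j → c ≤ f j) → fromℕ (m ∸ toℕ a) * c ≤ ΣFin f
tail-≤-Σ fzero    f≥0 c≤f = const-≤-Σ (λ j → c≤f j ℕ.z≤n)
tail-≤-Σ (fsuc a) f≥0 c≤f =
  ℚP.≤-trans (tail-≤-Σ a (f≥0 ∘ fsuc) (λ j a≤j → c≤f (fsuc j) (ℕ.s≤s a≤j)))
    (ℚP.≤-trans (ℚP.≤-reflexive (≡.sym (ℚP.+-identityˡ _))) (ℚP.+-monoˡ-≤ _ (f≥0 fzero)))

∸-toℕ : ∀ {k} (j : Fin k) → k ∸ toℕ j ≡ suc (k ∸ suc (toℕ j))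
∸-toℕ {suc k} j = ℕP.+-∸-assoc 1 (FinP.toℕ≤pred[n] j)

step-mono⇒mono : ∀ {k} (f : Fin k → ℚ) → (∀ i j → toℕ j ≡ suc (toℕ i) → f i ≤ f j) →
  ∀ {i j} → toℕ i ℕ.≤ toℕ j → f i ≤ f j
step-mono⇒mono {k} f f-step {i} {j} i≤j = go (toℕ j ∸ toℕ i) j (≡.sym (ℕP.m+[n∸m]≡n i≤j))
  where
  go : ∀ d j → toℕ j ≡ toℕ i ℕ.+ d → f i ≤ f j
  go zero    j j≡i+0 =
    ℚP.≤-reflexive (cong f (FinP.toℕ-injective (trans (≡.sym (ℕP.+-identityʳ _)) (≡.sym j≡i+0))))
  go (suc d) j j≡i+1+d = ℚP.≤-trans (go d j′ (FinP.toℕ-fromℕ< i+d<k)) (f-step j′ j j≡1+j′)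
    where
    j≡1+i+d : toℕ j ≡ suc (toℕ i ℕ.+ d)
    j≡1+i+d = trans j≡i+1+d (ℕP.+-suc _ _)
    i+d<k : toℕ i ℕ.+ d ℕ.< k
    i+d<k = subst (ℕ._≤ k) j≡1+i+d (ℕP.<⇒≤ (FinP.toℕ<n j))
    j′ = fromℕ< i+d<k
    j≡1+j′ : toℕ j ≡ suc (toℕ j′)
    j≡1+j′ = trans j≡1+i+d (cong suc (≡.sym (FinP.toℕ-fromℕ< i+d<k)))

module _ {n} (w : Fin n → ℚ) where

  listMass : List (Fin n) → Fin n → ℚ
  listMass []      z = 0ℚ
  listMass (a ∷ Q) z = (if does (z FinP.≟ a) then w z else 0ℚ) + listMass Q z

  Σ-listMass : ∀ Q → ΣFin (listMass Q) ≡ wList w Q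
  Σ-listMass []      = Σ-zero n
  Σ-listMass (a ∷ Q) = trans (Σ-+ _ (listMass Q)) (cong₂ _+_ (Σ-singleton a w) (Σ-listMass Q))

  listMass-∉ : ∀ {z} Q → All (z ≢_) Q → listMass Q z ≡ 0ℚ
  listMass-∉       []      []           = refl
  listMass-∉ {z} (a ∷ Q) (z≢a ∷ z∉Q) with z FinP.≟ a
  ... | yes z≡a = ⊥-elim (z≢a z≡a)
  ... | no  _   = trans (ℚP.+-identityˡ _) (listMass-∉ Q z∉Q)

  wList-≤-Σ : (∀ z → 0ℚ ≤ w z) → (c : Fin n → Bool) → ∀ {Q} → Unique Q →
    All (λ z → c z ≡ true) Q → wList w Q ≤ ΣFin (λ z → w z * B→ℚ (c z))
  wList-≤-Σ w≥0 c {Q} Q-unique Q⊆c =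
    subst (_≤ _) (Σ-listMass Q) (Σ-mono (mass-≤ Q Q-unique Q⊆c))
    where
    mass-≤ : ∀ Q → Unique Q → All (λ z → c z ≡ true) Q → ∀ z → listMass Q z ≤ w z * B→ℚ (c z)
    mass-≤ [] _ _ z = weighted-bit-nonneg (w≥0 z) (c z)
    mass-≤ (a ∷ Q) (a∉Q ∷ Q-unique) (ca ∷ Q⊆c) z with z FinP.≟ a
    ... | yes refl = ℚP.≤-reflexive (begin
          w z + listMass Q z  ≡⟨ cong (w z +_) (listMass-∉ Q a∉Q) ⟩
          w z + 0ℚ            ≡⟨ ℚP.+-identityʳ (w z) ⟩
          w z                 ≡⟨ ≡.sym (ℚP.*-identityʳ (w z)) ⟩
          w z * 1ℚ            ≡⟨ cong (λ b → w z * B→ℚ b) (≡.sym ca) ⟩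
          w z * B→ℚ (c z)     ∎)
      where open ≡-Reasoning
    ... | no  _    = ℚP.≤-trans (ℚP.≤-reflexive (ℚP.+-identityˡ _)) (mass-≤ Q Q-unique Q⊆c z)

-- Separators

path-meets-separator : ∀ {n} {G : Graph n} {u v} {S : Subset n} {Q} →
  IsSeparator G u v S → IsPath G u v Q → ∃ λ z → z ∈ₗ Q × z ∈ S
path-meets-separator {S = S} {Q} (_ , _ , no-path-avoiding-S) Q-path =
  let z , z∈Q , ¬z∉S = find (¬All⇒Any¬ (λ z → ¬? (z SubsetP.∈? S)) Q
                              (λ Q-avoids-S → no-path-avoiding-S (Q , Q-path , Q-avoids-S)))
  in z , z∈Q , decidable-stable (z SubsetP.∈? S) ¬z∉S

-- Whether a strictly smaller separator exists is not decidable, hence the double negation.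
separator-⊇-minimal : ∀ {n} {G : Graph n} {u v} (S : Subset n) → IsSeparator G u v S →
  ¬ ¬ (∃ λ S′ → S′ ⊆ S × IsMinimalSeparator G u v S′)
separator-⊇-minimal {G = G} {u} {v} S S-sep = descend (suc ∣ S ∣) S ℕP.≤-refl S-sep
  where
  descend : ∀ fuel S → ∣ S ∣ ℕ.< fuel → IsSeparator G u v S →
    ¬ ¬ (∃ λ S′ → S′ ⊆ S × IsMinimalSeparator G u v S′)
  descend (suc fuel) S ∣S∣<1+fuel S-sep no-minimal =
    ¬¬-excluded-middle {A = ∃ λ S′ → S′ ⊂ S × IsSeparator G u v S′} λ where
    (yes (S′ , S′⊂S , S′-sep)) →
      descend fuel S′ (ℕP.<-≤-trans (SubsetP.p⊂q⇒∣p∣<∣q∣ S′⊂S) (ℕP.≤-pred ∣S∣<1+fuel)) S′-sep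
        λ (S″ , S″⊆S′ , S″-min) →
          no-minimal (S″ , (λ z∈S″ → proj₁ S′⊂S (S″⊆S′ z∈S″)) , S″-min)
    (no no-smaller) →
      no-minimal (S , (λ z∈S → z∈S) , S-sep ,
                  λ S′ S′⊂S S′-sep → no-smaller (S′ , S′⊂S , S′-sep))

∈-tabulate : ∀ {n} {f : Fin n → Bool} {z} → z ∈ tabulate f → f z ≡ true
∈-tabulate {f = f} {z} z∈ = trans (≡.sym (VecP.lookup∘tabulate f z)) (VecP.[]=⇒lookup z∈)

tabulate-∈ : ∀ {n} {f : Fin n → Bool} {z} → f z ≡ true → z ∈ tabulate f
tabulate-∈ {f = f} {z} fz = VecP.lookup⇒[]= z (tabulate f) (trans (VecP.lookup∘tabulate f z) fz)

-- Feasible 0/1 points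

minus-nonneg-≤ : ∀ {a s c} → 0ℚ ≤ s → a ≤ c → a - s ≤ c
minus-nonneg-≤ {a} s≥0 a≤c = ℚP.≤-trans (ℚP.+-monoʳ-≤ a (ℚP.neg-antimono-≤ s≥0))
                               (ℚP.≤-trans (ℚP.≤-reflexive (ℚP.+-identityʳ a)) a≤c)

bits-sepForm-≤ : ∀ a b {s} → 0ℚ ≤ s → (a ≡ true → b ≡ true → 1ℚ ≤ s) →
  (B→ℚ a + B→ℚ b) - s ≤ 1ℚ
bits-sepForm-≤ true  true  _   s≥1 =
  ℚP.≤-trans (ℚP.+-monoʳ-≤ (1ℚ + 1ℚ) (ℚP.neg-antimono-≤ (s≥1 refl refl)))
             (from-yes (((1ℚ + 1ℚ) - 1ℚ) ℚP.≤? 1ℚ))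
bits-sepForm-≤ true  false s≥0 _   = minus-nonneg-≤ s≥0 (from-yes ((1ℚ + 0ℚ) ℚP.≤? 1ℚ))
bits-sepForm-≤ false true  s≥0 _   = minus-nonneg-≤ s≥0 (from-yes ((0ℚ + 1ℚ) ℚP.≤? 1ℚ))
bits-sepForm-≤ false false s≥0 _   = minus-nonneg-≤ s≥0 (from-yes ((0ℚ + 0ℚ) ℚP.≤? 1ℚ))

module FeasiblePoint {n k} (G : Graph n) (w : Fin n → ℚ) (w≥0 : ∀ z → 0ℚ ≤ w z)
  (u v : Fin n) (u≢v : u ≢ v) (u≁v : ¬ Adj G u v)
  (S : Subset n) (S-sep : IsSeparator G u v S) (i : Fin k)
  (T : Subset n) (S∖L⊆T : ∀ {z} → z ∈ S → ¬ InL k G w u v S i z → z ∈ T)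
  (y : Fin n → Fin k → Bool) (y-feasible : Feasible k G w y) where

  x : Point n k
  x z j = B→ℚ (y z j)

  classWeight : Fin k → ℚ
  classWeight j = ΣFin (λ z → w z * x z j)

  Σ-classWeight-≤ : ΣFin classWeight ≤ wGraph w
  Σ-classWeight-≤ = begin
    ΣFin classWeight                       ≡⟨ Σ-comm (λ j z → w z * x z j) ⟩
    ΣFin (λ z → ΣFin (λ j → w z * x z j))  ≡⟨ Σ-cong (λ z → Σ-*ˡ (w z) (x z)) ⟩
    ΣFin (λ z → w z * ΣFin (x z))          ≤⟨ Σ-mono (λ z → ℚP.*-monoˡ-≤-nonNeg (w z)
                                                 {{nonNegative (w≥0 z)}} (proj₁ (proj₂ y-feasible) z)) ⟩
    ΣFin (λ z → w z * 1ℚ)                  ≡⟨ Σ-cong (λ z → ℚP.*-identityʳ (w z)) ⟩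
    wGraph w                               ∎
    where open ℚP.≤-Reasoning

  classWeight≤threshold : ∀ j → classWeight j ≤ threshold k w j
  classWeight≤threshold j = ≤-*-recip (k ∸ suc (toℕ j))
    (subst (λ m → fromℕ m * classWeight j ≤ wGraph w) (∸-toℕ j)
      (ℚP.≤-trans (tail-≤-Σ j classWeight-nonneg (λ _ → classWeight-mono)) Σ-classWeight-≤))
    where
    classWeight-nonneg : ∀ j → 0ℚ ≤ classWeight j
    classWeight-nonneg j = Σ-nonneg (λ z → weighted-bit-nonneg (w≥0 z) (y z j))
    classWeight-mono : ∀ {i j} → toℕ i ℕ.≤ toℕ j → classWeight i ≤ classWeight j
    classWeight-mono = step-mono⇒mono classWeight (proj₁ y-feasible)

  InClass : Fin n → Set
  InClass z = y z i ≡ true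

  class-connects : InClass u → InClass v → ¬ ¬ (∃ λ Q → IsPath G u v Q × All InClass Q)
  class-connects u∈class v∈class no-class-path =
    separator-⊇-minimal outside outside-separates no-minimal-inside
    where
    outside : Subset n
    outside = tabulate (λ z → not (y z i))

    outside⇒false : ∀ {z} → z ∈ outside → y z i ≡ false
    outside⇒false {z} z∈ = trans (≡.sym (BoolP.not-involutive (y z i))) (cong not (∈-tabulate z∈))

    ∉outside⇒InClass : ∀ {z} → z ∉ outside → InClass z
    ∉outside⇒InClass {z} z∉ with y z i in yz
    ... | true  = refl
    ... | false = ⊥-elim (z∉ (tabulate-∈ (cong not yz)))

    InClass⇒∉outside : ∀ {z} → InClass z → z ∉ outside
    InClass⇒∉outside z∈class z∈ = BoolP.not-¬ z∈class (outside⇒false z∈)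

    outside-separates : IsSeparator G u v outside
    outside-separates = InClass⇒∉outside u∈class , InClass⇒∉outside v∈class ,
      λ (Q , Q-path , Q-avoids) → no-class-path (Q , Q-path , All.map ∉outside⇒InClass Q-avoids)

    no-minimal-inside : ¬ (∃ λ S′ → S′ ⊆ outside × IsMinimalSeparator G u v S′)
    no-minimal-inside (S′ , S′⊆outside , S′-min) =
      from-no (((1ℚ + 1ℚ) - 0ℚ) ℚP.≤? 1ℚ)
        (subst (_≤ 1ℚ) (cong₂ _-_ (cong₂ _+_ (cong B→ℚ u∈class) (cong B→ℚ v∈class)) ΣS′≡0)
          (proj₂ (proj₂ y-feasible) u v S′ i u≢v u≁v S′-min))
      where
      ΣS′≡0 : ΣOver S′ (λ z → x z i) ≡ 0ℚ
      ΣS′≡0 = ΣOver-vanishing S′ (λ z∈S′ → cong B→ℚ (outside⇒false (S′⊆outside z∈S′)))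

  class-path-meets-T : ∀ {Q} → IsPath G u v Q → All InClass Q → ∃ λ z → z ∈ T × InClass z
  class-path-meets-T {Q} Q-path Q⊆class =
    let z , z∈Q , z∈S = path-meets-separator S-sep Q-path
    in z , S∖L⊆T z∈S (∉L z∈Q) , All.lookup Q⊆class z∈Q
    where
    ∉L : ∀ {z} → z ∈ₗ Q → ¬ InL k G w u v S i z
    ∉L z∈Q (_ , P , (_ , _ , P-min) , threshold<wP) =
      ℚP.<-irrefl refl (ℚP.<-≤-trans threshold<wP wP≤threshold)
      where
      open ℚP.≤-Reasoning
      wP≤threshold : wList w P ≤ threshold k w i
      wP≤threshold = begin
        wList w P        ≤⟨ P-min Q Q-path z∈Q ⟩
        wList w Q        ≤⟨ wList-≤-Σ w w≥0 (λ z → y z i) (proj₂ Q-path) Q⊆class ⟩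
        classWeight i    ≤⟨ classWeight≤threshold i ⟩
        threshold k w i  ∎

  separator-inequality : sepForm u v T (λ z → x z i) ≤ 1ℚ
  separator-inequality = bits-sepForm-≤ (y u i) (y v i) (ΣOver-nonneg T x≥0) λ u∈class v∈class →
    decidable-stable (1ℚ ℚP.≤? _) λ 1≰Σ →
      class-connects u∈class v∈class λ (Q , Q-path , Q⊆class) →
        let z , z∈T , z∈class = class-path-meets-T Q-path Q⊆class
        in 1≰Σ (subst (_≤ _) (cong B→ℚ z∈class) (member-≤-ΣOver x≥0 z∈T))
    where
    x≥0 : ∀ z → 0ℚ ≤ x z i
    x≥0 z = B→ℚ-nonneg (y z i)

mainTheorem2 : (n k : ℕ) → k ≥ 1 → (G : Graph n) → Connected G →
    (w : Fin n → ℚ) → (∀ v → 0ℚ < w v) →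
    (u v : Fin n) → u ≢ v → ¬ Adj G u v →
    (S : Subset n) → IsMinimalSeparator G u v S →
    (i : Fin k) →
    -- T is the set S ∖ L
    (T : Subset n) → (∀ z → (z ∈ T) ⇔ (z ∈ S × ¬ InL k G w u v S i z)) →
    (x : Point n k) → InPolytope k G w x →
    (x u i + x v i) - ΣOver T (λ z → x z i) ≤ 1ℚ
mainTheorem2 n k _ G _ w w>0 u v u≢v u≁v S S-min i T T≡S∖L x
             (m , p , λs , p-feasible , λs≥0 , Σλs≡1 , x≡) = begin
  sepForm u v T (λ z → x z i)
    ≡⟨ sepForm-cong u v T (λ z → x≡ z i) ⟩
  sepForm u v T (λ z → ΣFin (λ j → λs j * vertex j z))
    ≡⟨ sepForm-linear u v T λs vertex ⟩
  ΣFin (λ j → λs j * sepForm u v T (vertex j))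
    ≤⟨ convex-combination-≤ λs≥0 Σλs≡1 vertex-valid ⟩
  1ℚ ∎
  where
  open ℚP.≤-Reasoning
  vertex : Fin m → Fin n → ℚ
  vertex j z = B→ℚ (p j z i)
  vertex-valid : ∀ j → sepForm u v T (vertex j) ≤ 1ℚ
  vertex-valid j =
    FeasiblePoint.separator-inequality G w (ℚP.<⇒≤ ∘ w>0) u v u≢v u≁v S (proj₁ S-min) i T
      (λ z∈S z∉L → Equivalence.from (T≡S∖L _) (z∈S , z∉L)) (p j) (p-feasible j)
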